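{- Presheaf-valued models satisfy the Negative Constant Domain Principle: for every presheaf-valued structure over a topological space $B$ with nonempty domain $D$, every instance of the schema $\forall x\,(\neg\alpha\lor\pi(x))\to\neg\alpha\lor\forall x\,\pi(x)$ (where $x$ is not free in $\alpha$) is valid in the structure.
   Context: Presheaves on $B$ are functors from open subsets (with inclusions) to sets; product and coproduct are objectwise, $\mathrm{Hom}(F,G)(U)$ is the set of presheaf morphisms $F|_U\to G|_U$, and $\mathrm{Char}\,\emptyset$ has one-point value on $\emptyset$ and empty value elsewhere. A presheaf-valued structure over $B$ with domain $D$ assigns a presheaf to each $n$-ary predicate variable and each tuple of $D^n$, and interprets formulas under a valuation $\mu$ by $\lor\mapsto$ coproduct, $\land\mapsto$ product, $\to\mapsto\mathrm{Hom}$, $\bot\mapsto\mathrm{Char}\,\emptyset$, $\neg\alpha:=\alpha\to\bot$, $\exists x\mapsto\bigsqcup_{d\in D}$, $\forall x\mapsto\prod_{d\in D}$ (over $\mu[x\mapsto d]$). A formula $\phi$ is valid if $|\phi|_\mu(B)\ne\emptyset$ for every valuation $\mu$. An instance of a schema is obtained by substituting arbitrary formulas (with capture-avoiding conventions) for $\alpha$ and $\pi(x)$. -}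

module Defs where

open import Level using (Level; 0ℓ; Lift; lift) renaming (suc to lsuc)
open import Data.Nat using (ℕ; _≡ᵇ_)
open import Data.Bool using (if_then_else_)
open import Data.Vec using (Vec; map)
open import Data.Vec.Membership.Propositional using (_∈_)
open import Data.Unit.Polymorphic using (⊤)
open import Data.Empty using (⊥)
open import Data.Product using (Σ; _×_; _,_)
open import Data.Sum using (_⊎_; inj₁; inj₂)
open import Data.Irrelevant using (Irrelevant; [_])
open import Relation.Unary using (Pred)
open import Relation.Binary.PropositionalEquality using (_≡_)

record Space : Set₁ where
  field
    Pt      : Set
    IsOpen  : Pred Pt 0ℓ → Set
    open-univ : IsOpen (λ _ → ⊤)
    open-∩  : ∀ {U V} → IsOpen U → IsOpen V → IsOpen (λ x → U x × V x)
    open-⋃  : {I : Set} (f : I → Pred Pt 0ℓ) → (∀ i → IsOpen (f i)) →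
              IsOpen (λ x → Σ I (λ i → f i x))

module _ (T : Space) where
  open Space T

  record Open : Set₁ where
    constructor mkOpen
    field
      carrier : Pred Pt 0ℓ
      .isOpen : IsOpen carrier
  open Open public

  -- inclusion V ⊆ U of open sets (the unique arrow V → U of the poset of opens;
  -- it is always used irrelevantly, so the category of opens is thin)
  _⊆ₒ_ : Open → Open → Set
  V ⊆ₒ U = ∀ {x} → carrier V x → carrier U x

  whole : Open
  whole = mkOpen (λ _ → ⊤) open-univ

  record PreSh : Set₂ where
    field
      obj : Open → Set₁
      res : ∀ {U V} → .(V ⊆ₒ U) → obj U → obj V
  open PreSh public

  record Presheaf : Set₂ where
    field
      preSh  : PreSh
      res-id : ∀ {U} .(p : U ⊆ₒ U) (s : obj preSh U) → res preSh p s ≡ s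
      res-∘  : ∀ {U V W} .(p : V ⊆ₒ U) .(q : W ⊆ₒ V) .(r : W ⊆ₒ U)
               (s : obj preSh U) → res preSh {V} {W} q (res preSh {U} {V} p s) ≡ res preSh r s
  open Presheaf public

  -- Hom(F,G)(U): presheaf morphisms F|_U → G|_U (natural transformations)
  record HomAt (F G : PreSh) (U : Open) : Set₁ where
    constructor mkHom
    field
      η : (V : Open) → .(V ⊆ₒ U) → obj F V → obj G V
      .natural : ∀ (V W : Open) .(p : V ⊆ₒ U) .(q : W ⊆ₒ V) (s : obj F V) →
                 η W (λ w → p (q w)) (res F q s) ≡ res G q (η V p s)
  open HomAt public

  Hom : PreSh → PreSh → PreSh
  obj (Hom F G) U = HomAt F G U
  res (Hom F G) r (mkHom h nat) =
    mkHom (λ V p → h V (λ v → r (p v))) (λ V W p q s → nat V W (λ v → r (p v)) q s)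

  _⊕_ : PreSh → PreSh → PreSh
  obj (F ⊕ G) U = obj F U ⊎ obj G U
  res (F ⊕ G) p (inj₁ s) = inj₁ (res F p s)
  res (F ⊕ G) p (inj₂ s) = inj₂ (res G p s)

  _⊗_ : PreSh → PreSh → PreSh
  obj (F ⊗ G) U = obj F U × obj G U
  res (F ⊗ G) p (s , t) = res F p s , res G p t

  -- Char ∅ : one point on the empty open set, empty elsewhere
  Char∅ : PreSh
  obj Char∅ U = Lift (lsuc 0ℓ) (Irrelevant (∀ x → carrier U x → ⊥))
  res Char∅ p (lift [ e ]) = lift [ (λ x v → e x (p v)) ]

  ⨆ : (D : Set) → (D → PreSh) → PreSh
  obj (⨆ D F) U = Σ D (λ d → obj (F d) U)
  res (⨆ D F) p (d , s) = d , res (F d) p s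

  ⨅ : (D : Set) → (D → PreSh) → PreSh
  obj (⨅ D F) U = (d : D) → obj (F d) U
  res (⨅ D F) p s d = res (F d) p (s d)

Var : Set
Var = ℕ

infixr 6 _∧'_
infixr 5 _∨'_
infixr 4 _⇒_

data Formula : Set where
  pv    : (P n : ℕ) → Vec Var n → Formula
  ⊥'    : Formula
  _∧'_  : Formula → Formula → Formula
  _∨'_  : Formula → Formula → Formula
  _⇒_   : Formula → Formula → Formula
  ∀'    : Var → Formula → Formula
  ∃'    : Var → Formula → Formula

¬' : Formula → Formula
¬' α = α ⇒ ⊥'

data FreeIn (x : Var) : Formula → Set where
  free-pv : ∀ {P n} {ys : Vec Var n} → x ∈ ys → FreeIn x (pv P n ys)
  free-∧ˡ : ∀ {φ ψ} → FreeIn x φ → FreeIn x (φ ∧' ψ)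
  free-∧ʳ : ∀ {φ ψ} → FreeIn x ψ → FreeIn x (φ ∧' ψ)
  free-∨ˡ : ∀ {φ ψ} → FreeIn x φ → FreeIn x (φ ∨' ψ)
  free-∨ʳ : ∀ {φ ψ} → FreeIn x ψ → FreeIn x (φ ∨' ψ)
  free-⇒ˡ : ∀ {φ ψ} → FreeIn x φ → FreeIn x (φ ⇒ ψ)
  free-⇒ʳ : ∀ {φ ψ} → FreeIn x ψ → FreeIn x (φ ⇒ ψ)
  free-∀  : ∀ {y φ} → (x ≡ y → ⊥) → FreeIn x φ → FreeIn x (∀' y φ)
  free-∃  : ∀ {y φ} → (x ≡ y → ⊥) → FreeIn x φ → FreeIn x (∃' y φ)

record Structure (T : Space) : Set₂ where
  field
    D    : Set
    pred : (P n : ℕ) → Vec D n → Presheaf T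
open Structure public

module _ {T : Space} (M : Structure T) where

  Valuation : Set
  Valuation = Var → D M

  _[_↦_] : Valuation → Var → D M → Valuation
  (μ [ x ↦ d ]) y = if y ≡ᵇ x then d else μ y

  ⟦_⟧ : Formula → Valuation → PreSh T
  ⟦ pv P n ys ⟧ μ = preSh (pred M P n (map μ ys))
  ⟦ ⊥' ⟧ μ = Char∅ T
  ⟦ φ ∧' ψ ⟧ μ = _⊗_ T (⟦ φ ⟧ μ) (⟦ ψ ⟧ μ)
  ⟦ φ ∨' ψ ⟧ μ = _⊕_ T (⟦ φ ⟧ μ) (⟦ ψ ⟧ μ)
  ⟦ φ ⇒ ψ ⟧ μ = Hom T (⟦ φ ⟧ μ) (⟦ ψ ⟧ μ)
  ⟦ ∀' x φ ⟧ μ = ⨅ T (D M) (λ d → ⟦ φ ⟧ (μ [ x ↦ d ]))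
  ⟦ ∃' x φ ⟧ μ = ⨆ T (D M) (λ d → ⟦ φ ⟧ (μ [ x ↦ d ]))

  Valid : Formula → Set₁
  Valid φ = (μ : Valuation) → obj (⟦ φ ⟧ μ) (whole T)

NCD : Var → Formula → Formula → Formula
NCD x α π = ∀' x (¬' α ∨' π) ⇒ (¬' α ∨' ∀' x π)

module Submission where

-- Fix a valuation μ and write Aᵈ = |¬α|_{μ[x↦d]}, Bᵈ = |π|_{μ[x↦d]}.
-- A global section of |NCD x α π|_μ is a natural map
--   ∏_d (Aᵈ ⊔ Bᵈ)  ⟶  |¬α|_μ ⊔ ∏_d Bᵈ.
-- The proof rests on two observations.
--   (1) Coincidence: as x is not free in α, each Aᵈ maps into |¬α|_μ.
--       This is the usual coincidence lemma (valuations agreeing on the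
--       free variables of φ give interpretations of φ related by presheaf
--       morphisms), proved by induction on formulas from the functoriality
--       of the connectives.
--   (2) Negations are propositional: every Hom(F, Char ∅)(U) has at most
--       one element.
-- Given these, a section s over V is sent (deciding by excluded middle)
-- to the left summand if some s d lies in the left summand Aᵈ, and to
-- the right summand otherwise; propositionality of the left summand and
-- stability of "lies in the left summand" under restriction make this
-- natural.

open import Defs
open import Level using (Level) renaming (suc to lsuc)
open import Level using (0ℓ)
open import Relation.Nullary using (¬_)
open import Axiom.Extensionality.Propositional using (Extensionality)
open import Axiom.ExcludedMiddle using (ExcludedMiddle)

open import Axiom.Extensionality.Propositional using (lower-extensionality)
open import Data.Bool using (true; false)
open import Data.Empty using (⊥-elim)
open import Data.Empty.Polymorphic using (⊥)
open import Data.Unit.Polymorphic using (⊤)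
open import Data.Nat using (_≡ᵇ_)
open import Data.Nat.Properties using (≡⇒≡ᵇ; ≡ᵇ⇒≡)
open import Data.Product using (Σ; _,_)
open import Data.Sum using (_⊎_; inj₁; inj₂)
open import Data.Vec using (Vec; []; _∷_; map)
open import Data.Vec.Membership.Propositional using (_∈_)
open import Data.Vec.Relation.Unary.Any using (here; there)
open import Relation.Nullary using (Dec; yes; no)
open import Relation.Binary.PropositionalEquality
  using (_≡_; refl; sym; cong; cong₂; module ≡-Reasoning)

module Morphisms (T : Space) where

  record _⇛_ (F G : PreSh T) : Set₁ where
    field
      at      : ∀ U → obj F U → obj G U
      natural : ∀ {U V} .(q : _⊆ₒ_ T V U) (s : obj F U) →
                at V (res F q s) ≡ res G q (at U s)
  open _⇛_ public

  id⇛ : ∀ {F} → F ⇛ F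
  id⇛ = record { at = λ _ s → s ; natural = λ _ _ → refl }

  ≡⇒⇛ : ∀ {F G} → F ≡ G → F ⇛ G
  ≡⇒⇛ refl = id⇛

  ⇛⇒Hom : ∀ {F G} → F ⇛ G → ∀ U → obj (Hom T F G) U
  ⇛⇒Hom f U = mkHom (λ V _ → at f V) (λ V W _ q s → natural f q s)

  ⊗-map : ∀ {F F' G G'} → F ⇛ F' → G ⇛ G' → _⊗_ T F G ⇛ _⊗_ T F' G'
  ⊗-map f g = record
    { at      = λ { U (s , t) → at f U s , at g U t }
    ; natural = λ { q (s , t) → cong₂ _,_ (natural f q s) (natural g q t) }
    }

  ⊕-map : ∀ {F F' G G'} → F ⇛ F' → G ⇛ G' → _⊕_ T F G ⇛ _⊕_ T F' G'
  ⊕-map {F} {F'} {G} {G'} f g = record { at = at⊕ ; natural = natural⊕ }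
    where
      at⊕ : ∀ U → obj (_⊕_ T F G) U → obj (_⊕_ T F' G') U
      at⊕ U (inj₁ s) = inj₁ (at f U s)
      at⊕ U (inj₂ t) = inj₂ (at g U t)

      natural⊕ : ∀ {U V} .(q : _⊆ₒ_ T V U) (s : obj (_⊕_ T F G) U) →
                 at⊕ V (res (_⊕_ T F G) q s) ≡ res (_⊕_ T F' G') q (at⊕ U s)
      natural⊕ q (inj₁ s) = cong inj₁ (natural f q s)
      natural⊕ q (inj₂ t) = cong inj₂ (natural g q t)

  -- A section h of Hom(F, G) becomes g ∘ h ∘ f, natural because f, h, g are;
  -- the induced map commutes with restriction definitionally.
  Hom-map : ∀ {F F' G G'} → F' ⇛ F → G ⇛ G' → Hom T F G ⇛ Hom T F' G'
  Hom-map {F} {F'} {G} {G'} f g = record { at = atHom ; natural = λ _ _ → refl }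
    where
      atHom : ∀ U → obj (Hom T F G) U → obj (Hom T F' G') U
      atHom U (mkHom h nat) = mkHom (λ V p s → at g V (h V p (at f V s)))
        (λ V W p q s → composite-natural V W p q s (nat V W p q (at f V s)))
        where
          open ≡-Reasoning
          composite-natural : ∀ V W .(p : _⊆ₒ_ T V U) .(q : _⊆ₒ_ T W V) (s : obj F' V) →
            h W (λ w → p (q w)) (res F q (at f V s)) ≡ res G q (h V p (at f V s)) →
            at g W (h W (λ w → p (q w)) (at f W (res F' q s)))
              ≡ res G' q (at g V (h V p (at f V s)))
          composite-natural V W p q s h-natural = begin
            at g W (h W _ (at f W (res F' q s)))
              ≡⟨ cong (λ t → at g W (h W (λ w → p (q w)) t)) (natural f q s) ⟩
            at g W (h W _ (res F q (at f V s)))    ≡⟨ cong (at g W) h-natural ⟩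
            at g W (res G q (h V p (at f V s)))    ≡⟨ natural g q (h V p (at f V s)) ⟩
            res G' q (at g V (h V p (at f V s)))   ∎

  ⨆-map : ∀ {D F G} → (∀ d → F d ⇛ G d) → ⨆ T D F ⇛ ⨆ T D G
  ⨆-map f = record
    { at      = λ { U (d , s) → d , at (f d) U s }
    ; natural = λ { q (d , s) → cong (d ,_) (natural (f d) q s) }
    }

  ⨅-map : Extensionality 0ℓ (lsuc 0ℓ) →
          ∀ {D F G} → (∀ d → F d ⇛ G d) → ⨅ T D F ⇛ ⨅ T D G
  ⨅-map ext f = record
    { at      = λ U s d → at (f d) U (s d)
    ; natural = λ q s → ext (λ d → natural (f d) q (s d))
    }

module Coincidence {T : Space} (M : Structure T)
                   (ext : Extensionality 0ℓ (lsuc 0ℓ)) where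
  open Morphisms T

  Agree : Formula → Valuation M → Valuation M → Set
  Agree φ μ μ' = ∀ {z} → FreeIn z φ → μ z ≡ μ' z

  update-other : ∀ (μ : Valuation M) {x z} d → ¬ z ≡ x → _[_↦_] M μ x d z ≡ μ z
  update-other μ {x} {z} d z≢x with z ≡ᵇ x | ≡ᵇ⇒≡ z x
  ... | false | _   = refl
  ... | true  | to≡ = ⊥-elim (z≢x (to≡ _))

  update-agree : ∀ {φ μ μ'} y → (∀ {z} → ¬ z ≡ y → FreeIn z φ → μ z ≡ μ' z) →
                 ∀ d → Agree φ (_[_↦_] M μ y d) (_[_↦_] M μ' y d)
  update-agree y ag d {z} f with z ≡ᵇ y | ≡⇒≡ᵇ z y
  ... | true  | _    = refl
  ... | false | from = ag from f

  update-not-free : ∀ {φ} μ x d → ¬ FreeIn x φ → Agree φ (_[_↦_] M μ x d) μ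
  update-not-free μ x d x∉φ f = update-other μ d (λ { refl → x∉φ f })

  not-free-¬ : ∀ {x α} → ¬ FreeIn x α → ¬ FreeIn x (¬' α)
  not-free-¬ x∉α (free-⇒ˡ f) = x∉α f
  not-free-¬ x∉α (free-⇒ʳ ())

  map-agree : ∀ {n} {μ μ' : Valuation M} (ys : Vec Var n) →
              (∀ {z} → z ∈ ys → μ z ≡ μ' z) → map μ ys ≡ map μ' ys
  map-agree []       ag = refl
  map-agree (y ∷ ys) ag = cong₂ _∷_ (ag (here refl)) (map-agree ys (λ m → ag (there m)))

  coincidence : ∀ φ {μ μ'} → Agree φ μ μ' → ⟦_⟧ M φ μ ⇛ ⟦_⟧ M φ μ'
  coincidence (pv P n ys) ag =
    ≡⇒⇛ (cong (λ v → preSh (pred M P n v)) (map-agree ys (λ m → ag (free-pv m))))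
  coincidence ⊥'       ag = id⇛
  coincidence (φ ∧' ψ) ag =
    ⊗-map (coincidence φ (λ f → ag (free-∧ˡ f))) (coincidence ψ (λ f → ag (free-∧ʳ f)))
  coincidence (φ ∨' ψ) ag =
    ⊕-map (coincidence φ (λ f → ag (free-∨ˡ f))) (coincidence ψ (λ f → ag (free-∨ʳ f)))
  coincidence (φ ⇒ ψ)  ag =
    Hom-map (coincidence φ (λ f → sym (ag (free-⇒ˡ f)))) (coincidence ψ (λ f → ag (free-⇒ʳ f)))
  coincidence (∀' y φ) ag =
    ⨅-map ext (λ d → coincidence φ (update-agree y (λ z≢y f → ag (free-∀ z≢y f)) d))
  coincidence (∃' y φ) ag =
    ⨆-map (λ d → coincidence φ (update-agree y (λ z≢y f → ag (free-∃ z≢y f)) d))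

module ConstantDomain (T : Space) where
  open Morphisms T

  IsProp : PreSh T → Set₁
  IsProp N = ∀ U (s t : obj N U) → s ≡ t

  -- Negations are propositional: Char ∅ has at most one section over each
  -- open set, and naturality is proof-irrelevant, so this holds definitionally.
  negation-isProp : ∀ F → IsProp (Hom T F (Char∅ T))
  negation-isProp F U s t = refl

  IsLeft : {X Y : Set₁} → X ⊎ Y → Set₁
  IsLeft (inj₁ _) = ⊤
  IsLeft (inj₂ _) = ⊥

  left : {X Y : Set₁} (t : X ⊎ Y) → IsLeft t → X
  left (inj₁ x) _ = x

  right : {X Y : Set₁} (t : X ⊎ Y) → ¬ IsLeft t → Y
  right (inj₁ _) n = ⊥-elim (n _)
  right (inj₂ y) _ = y

  module _ {F G : PreSh T} {U V : Open T} .(q : _⊆ₒ_ T V U) where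

    restrict : obj (_⊕_ T F G) U → obj (_⊕_ T F G) V
    restrict = res (_⊕_ T F G) q

    isLeft-res : (t : obj (_⊕_ T F G) U) → IsLeft t → IsLeft (restrict t)
    isLeft-res (inj₁ _) l = l

    isLeft-unres : (t : obj (_⊕_ T F G) U) → IsLeft (restrict t) → IsLeft t
    isLeft-unres (inj₁ _) l = l

    right-res : (t : obj (_⊕_ T F G) U) (n : ¬ IsLeft t) (n' : ¬ IsLeft (restrict t)) →
                right (restrict t) n' ≡ res G q (right t n)
    right-res (inj₁ _) n _ = ⊥-elim (n _)
    right-res (inj₂ _) _ _ = refl

  -- The constant domain principle for a propositional presheaf N receiving
  -- maps from every A d:  ∏_d (A d ⊔ B d) ⇛ N ⊔ ∏_d B d.
  -- The maps into N need not be natural, since N is propositional.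
  module _ (lem : ExcludedMiddle (lsuc 0ℓ)) (ext : Extensionality 0ℓ (lsuc 0ℓ))
           {D : Set} {A B : D → PreSh T} {N : PreSh T}
           (N-prop : IsProp N) (toN : ∀ d U → obj (A d) U → obj N U) where

    Src Tgt : PreSh T
    Src = ⨅ T D (λ d → _⊕_ T (A d) (B d))
    Tgt = _⊕_ T N (⨅ T D B)

    SomeLeft : ∀ U → obj Src U → Set₁
    SomeLeft U s = Σ D (λ d → IsLeft (s d))

    choose : ∀ U (s : obj Src U) → Dec (SomeLeft U s) → obj Tgt U
    choose U s (yes (d , l)) = inj₁ (toN d U (left (s d) l))
    choose U s (no n)        = inj₂ (λ d → right (s d) (λ l → n (d , l)))

    choose-natural : ∀ {U V} .(q : _⊆ₒ_ T V U) (s : obj Src U)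
                     (a : Dec (SomeLeft U s)) (b : Dec (SomeLeft V (res Src q s))) →
                     choose V (res Src q s) b ≡ res Tgt q (choose U s a)
    choose-natural {V = V} q s (yes _) (yes _) = cong inj₁ (N-prop V _ _)
    choose-natural q s (yes (d , l)) (no n') = ⊥-elim (n' (d , isLeft-res {A d} {B d} q (s d) l))
    choose-natural q s (no n) (yes (d , l')) = ⊥-elim (n (d , isLeft-unres {A d} {B d} q (s d) l'))
    choose-natural q s (no n) (no n') =
      cong inj₂ (ext (λ d → right-res {A d} {B d} q (s d) (λ l → n (d , l)) (λ l → n' (d , l))))

    constant-domain : Src ⇛ Tgt
    constant-domain = record
      { at      = λ U s → choose U s lem
      ; natural = λ q s → choose-natural q s lem lem
      }

-- The theorem.
proposition6p22 : Extensionality (lsuc 0ℓ) (lsuc 0ℓ) → ExcludedMiddle (lsuc 0ℓ) →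
    (T : Space) (M : Structure T) → D M →
    (x : Var) (α π : Formula) → ¬ FreeIn x α → Valid M (NCD x α π)
proposition6p22 ext lem T M _ x α π x∉α μ =
  ⇛⇒Hom (constant-domain lem ext₀ (negation-isProp (⟦_⟧ M α μ)) ¬α-at-μ) (whole T)
  where
    ext₀ : Extensionality 0ℓ (lsuc 0ℓ)
    ext₀ = lower-extensionality (lsuc 0ℓ) 0ℓ ext

    open Morphisms T
    open Coincidence M ext₀
    open ConstantDomain T

    ¬α-at-μ : ∀ d U → obj (⟦_⟧ M (¬' α) (_[_↦_] M μ x d)) U → obj (⟦_⟧ M (¬' α) μ) U
    ¬α-at-μ d = at (coincidence (¬' α) (update-not-free μ x d (not-free-¬ x∉α)))
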